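{- For every integer $n\ge1$ and every $k\ge0$, the number of trees in $\mathcal{T}_{n-1}$ with exactly $k$ black nodes equals the number of $e\in\mathbf{I}_n(021)$ with exactly $k$ ascents.
   Context: An inversion sequence of length $n$ is an integer sequence $e=(e_1,\ldots,e_n)$ with $0 \le e_i < i$ for all $i$; $\mathbf{I}_n(021)$ is the set of those with no $i<j<k$ such that $e_i<e_k<e_j$. An ascent of $e$ is an index $i$ with $e_i<e_{i+1}$. $\mathcal{T}_m$ is the set of rooted binary trees (each node has at most one left child and at most one right child, distinguished) on $m$ nodes, each node colored black or white, such that no node has the same color as its right child; $\mathcal{T}_0$ consists of the empty tree. -}

module Defs where

open import Data.Nat using (ℕ; zero; suc; _+_; _<_; _<?_)
open import Data.Fin using (Fin; toℕ) renaming (_<_ to _<ᶠ_)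
open import Data.Vec using (Vec; lookup; toList)
open import Data.List using (List; []; _∷_)
open import Data.Product using (_×_)
open import Data.Unit using (⊤)
open import Relation.Nullary using (¬_; does)
open import Relation.Binary.PropositionalEquality using (_≡_; _≢_)
open import Data.Bool using (if_then_else_)

-- A subset type whose membership proof is irrelevant, so that two
-- elements are equal iff their underlying values are equal
-- (needed so that "number of elements" can be expressed by a bijection).
record Sub {A : Set} (P : A → Set) : Set where
  constructor ⟨_,_⟩
  field
    val   : A
    .prf  : P val

data Color : Set where
  black white : Color

data Tree : Set where
  leaf : Tree
  node : Color → Tree → Tree → Tree

size : Tree → ℕ
size leaf         = 0
size (node _ l r) = suc (size l + size r)

blackCount : Tree → ℕ
blackCount leaf             = 0
blackCount (node black l r) = suc (blackCount l + blackCount r)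
blackCount (node white l r) = blackCount l + blackCount r

DiffersFromRoot : Color → Tree → Set
DiffersFromRoot c leaf          = ⊤
DiffersFromRoot c (node c' _ _) = c ≢ c'

ValidColoring : Tree → Set
ValidColoring leaf         = ⊤
ValidColoring (node c l r) = ValidColoring l × ValidColoring r × DiffersFromRoot c r

TreesWithBlacks : ℕ → ℕ → Set
TreesWithBlacks m k =
  Sub (λ t → size t ≡ m × ValidColoring t × blackCount t ≡ k)

-- Inversion sequences (0-based positions: entry at position j is e_{j+1})

IsInversionSeq : {n : ℕ} → Vec ℕ n → Set
IsInversionSeq {n} e = (j : Fin n) → lookup e j < suc (toℕ j)

Avoids021 : {n : ℕ} → Vec ℕ n → Set
Avoids021 {n} e = (i j k : Fin n) → i <ᶠ j → j <ᶠ k →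
  ¬ (lookup e i < lookup e k × lookup e k < lookup e j)

ascentsL : List ℕ → ℕ
ascentsL []           = 0
ascentsL (x ∷ [])     = 0
ascentsL (x ∷ y ∷ xs) = (if does (x <? y) then 1 else 0) + ascentsL (y ∷ xs)

ascents : {n : ℕ} → Vec ℕ n → ℕ
ascents e = ascentsL (toList e)

Inv021WithAscents : ℕ → ℕ → Set
Inv021WithAscents n k =
  Sub (λ (e : Vec ℕ n) → IsInversionSeq e × Avoids021 e × ascents e ≡ k)

module Submission where

-- Both sides are put in bijection with one family of auxiliary "codes", given by
--     X ::= ε | Z X Y | P X Y          Y ::= ε | Q X Y .
-- (1) Trees ↔ codes.  A white node becomes a Z-node (left subtree as X-code,
--     black-or-empty right subtree as Y-code); a black node becomes a P-node,
--     or a Q-node when it is the right child of a white node, whose two parts are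
--     computed from its subtrees by `spine`, turning the chain of white left
--     children into further P-nodes.  Size is preserved and black nodes are
--     counted by the code statistic `xasc`.
-- (2) An inversion sequence avoids 021 iff its positive entries weakly increase;
--     such sequences are exactly the "admissible" lists.
-- (3) Codes ↔ sequences.  `encX m` writes a code out as a list: Z writes 0, P and
--     Q write the current level m, and the Y-part of a node is written at the
--     level just above the values of its X-part.  The encoding is length
--     preserving, admissible, turns `xasc` into ascents, and is uniquely and
--     completely decodable (by a greedy parser).
-- The theorem is the composite of the bijections (1) and (3).

open import Defs
open import Data.Nat
  using (ℕ; zero; suc; _+_; _∸_; _≤_; _<_; _≟_; _≤?_; _<?_; z≤n; s≤s; s≤s⁻¹)
open import Data.Nat.Properties
open import Data.Bool using (Bool; true; false; if_then_else_)
open import Data.Fin using (toℕ) renaming (zero to fzero; suc to fsuc; _<_ to _<ᶠ_)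
open import Data.List using (List; []; _∷_; _++_; length)
open import Data.List.Properties
  using (++-assoc; ++-identityʳ; length-++; length-++-≤ʳ; ∷-injectiveˡ; ∷-injectiveʳ)
open import Data.Vec using (Vec; lookup; toList) renaming ([] to []ᵛ; _∷_ to _∷ᵛ_)
open import Data.Vec.Properties using (length-toList; ∷-injective)
open import Data.Product using (_×_; _,_; proj₁; proj₂; ∃; map₁; map₂; uncurry)
open import Data.Sum using (_⊎_; inj₁; inj₂)
open import Data.Unit using (⊤; tt)
open import Data.Empty using (⊥-elim)
open import Relation.Nullary using (Dec; yes; no; does; ¬?)
open import Relation.Nullary.Decidable using (_×-dec_; _⊎-dec_; recompute; dec-true; dec-false)
open import Relation.Binary.PropositionalEquality
open import Function.Bundles using (_⤖_; _↔_; mk⤖; mk↔ₛ′)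
open import Function.Properties.Inverse using (↔⇒⤖)
open import Function.Construct.Composition using (_⤖-∘_)

-- X-codes and Y-codes; xzero, xlevel, ylevel are the nodes Z, P, Q above.
mutual
  data XCode : Set where
    xnil   : XCode
    xzero  : XCode → YCode → XCode
    xlevel : XCode → YCode → XCode

  data YCode : Set where
    ynil   : YCode
    ylevel : XCode → YCode → YCode

mutual
  xsize : XCode → ℕ
  xsize xnil         = 0
  xsize (xzero x y)  = suc (xsize x + ysize y)
  xsize (xlevel x y) = suc (xsize x + ysize y)

  ysize : YCode → ℕ
  ysize ynil         = 0
  ysize (ylevel x y) = suc (xsize x + ysize y)

nodeSize : XCode → YCode → ℕ
nodeSize x y = suc (xsize x + ysize y)

bit : Bool → ℕ
bit b = if b then 1 else 0

-- The flag `below` says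
-- whether the entry written just before the code lies below the code's level:
-- a P-node is an ascent exactly then, a Q-node always is.
mutual
  xasc : Bool → XCode → ℕ
  xasc below xnil         = 0
  xasc below (xzero x y)  = xasc true x + yasc y
  xasc below (xlevel x y) = bit below + (xasc false x + yasc y)

  yasc : YCode → ℕ
  yasc ynil         = 0
  yasc (ylevel x y) = suc (xasc false x + yasc y)

-- (1) Trees and codes

-- `toY` is meant for black-or-empty trees.  `spine t v` codes the two subtrees
-- t, v of a black node: every white node on the left chain of t becomes a P-node
-- (its right subtree giving the Y-part), and the chain ends with v as X-code and
-- the bottom (black or empty) tree as Y-code.
mutual
  toX : Tree → XCode
  toX leaf             = xnil
  toX (node white l r) = xzero (toX l) (toY r)
  toX (node black l r) = uncurry xlevel (spine l r)

  toY : Tree → YCode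
  toY leaf         = ynil
  toY (node _ l r) = uncurry ylevel (spine l r)

  spine : Tree → Tree → XCode × YCode
  spine (node white l r) v = map₁ (λ x → xlevel x (toY r)) (spine l v)
  spine leaf             v = toX v , ynil
  spine (node black a b) v = toX v , toY (node black a b)

mutual
  fromX : XCode → Tree
  fromX xnil         = leaf
  fromX (xzero x y)  = node white (fromX x) (fromY y)
  fromX (xlevel x y) = uncurry (node black) (unspine x y)

  fromY : YCode → Tree
  fromY ynil         = leaf
  fromY (ylevel x y) = uncurry (node black) (unspine x y)

  unspine : XCode → YCode → Tree × Tree
  unspine (xlevel x y') y = map₁ (λ t → node white t (fromY y')) (unspine x y)
  unspine xnil          y = fromY y , leaf
  unspine (xzero p q)   y = fromY y , node white (fromX p) (fromY q)

mutual
  toX-fromX : ∀ x → toX (fromX x) ≡ x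
  toX-fromX xnil         = refl
  toX-fromX (xzero x y)  = cong₂ xzero (toX-fromX x) (toY-fromY y)
  toX-fromX (xlevel x y) = cong (uncurry xlevel) (spine-unspine x y)

  toY-fromY : ∀ y → toY (fromY y) ≡ y
  toY-fromY ynil         = refl
  toY-fromY (ylevel x y) = cong (uncurry ylevel) (spine-unspine x y)

  spine-unspine : ∀ x y → uncurry spine (unspine x y) ≡ (x , y)
  spine-unspine (xlevel x y') y =
    cong₂ (λ p y'' → map₁ (λ z → xlevel z y'') p) (spine-unspine x y) (toY-fromY y')
  spine-unspine xnil        ynil         = refl
  spine-unspine xnil        (ylevel a b) = cong (xnil ,_) (toY-fromY (ylevel a b))
  spine-unspine (xzero p q) ynil         = cong (_, ynil) (toX-fromX (xzero p q))
  spine-unspine (xzero p q) (ylevel a b) =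
    cong₂ _,_ (toX-fromX (xzero p q)) (toY-fromY (ylevel a b))

-- Every validly coloured tree is recovered from its code; the colouring rule is
-- what makes the right subtree of a white node black-or-empty, and the second
-- subtree of a black node white-or-empty.
mutual
  fromX-toX : ∀ t → ValidColoring t → fromX (toX t) ≡ t
  fromX-toX leaf             _             = refl
  fromX-toX (node white l r) (vl , vr , d) = cong₂ (node white) (fromX-toX l vl) (fromY-toY r vr d)
  fromX-toX (node black l r) v             = cong (uncurry (node black)) (unspine-spine l r v)

  fromY-toY : ∀ t → ValidColoring t → DiffersFromRoot white t → fromY (toY t) ≡ t
  fromY-toY leaf             _ _ = refl
  fromY-toY (node black l r) v _ = cong (uncurry (node black)) (unspine-spine l r v)
  fromY-toY (node white l r) _ d = ⊥-elim (d refl)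

  unspine-spine : ∀ t v → ValidColoring (node black t v) → uncurry unspine (spine t v) ≡ (t , v)
  unspine-spine (node white l r) v ((vl , vr , d) , vv , dv) =
    cong₂ (λ p r' → map₁ (λ t → node white t r') p)
          (unspine-spine l v (vl , vv , dv)) (fromY-toY r vr d)
  unspine-spine leaf             v (_ , vv , dv) = unspine-toX v ynil vv dv
  unspine-spine (node black a b) v (vt , vv , dv) =
    trans (unspine-toX v (toY (node black a b)) vv dv)
          (cong (_, v) (fromY-toY (node black a b) vt (λ ())))

  unspine-toX : ∀ v y → ValidColoring v → DiffersFromRoot black v →
    unspine (toX v) y ≡ (fromY y , v)
  unspine-toX leaf             y _ _ = refl
  unspine-toX (node white p q) y (vp , vq , d) _ =
    cong (fromY y ,_) (cong₂ (node white) (fromX-toX p vp) (fromY-toY q vq d))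
  unspine-toX (node black p q) y _ d = ⊥-elim (d refl)

fromY-root : ∀ y → DiffersFromRoot white (fromY y)
fromY-root ynil         = tt
fromY-root (ylevel _ _) = λ ()

mutual
  fromX-valid : ∀ x → ValidColoring (fromX x)
  fromX-valid xnil         = tt
  fromX-valid (xzero x y)  = fromX-valid x , fromY-valid y , fromY-root y
  fromX-valid (xlevel x y) = unspine-valid x y

  fromY-valid : ∀ y → ValidColoring (fromY y)
  fromY-valid ynil         = tt
  fromY-valid (ylevel x y) = unspine-valid x y

  unspine-valid : ∀ x y → ValidColoring (uncurry (node black) (unspine x y))
  unspine-valid (xlevel x y') y with unspine-valid x y
  ... | vt , vb , db = (vt , fromY-valid y' , fromY-root y') , vb , db
  unspine-valid xnil        y = fromY-valid y , tt , tt
  unspine-valid (xzero p q) y = fromY-valid y , fromX-valid (xzero p q) , λ ()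

interchange : ∀ a b x y {c z} → a + b ≡ x + y → c ≡ z → a + c + b ≡ x + z + y
interchange a b x y {c} {z} ab≡xy c≡z = begin
  a + c + b   ≡⟨ +-assoc a c b ⟩
  a + (c + b) ≡⟨ cong (a +_) (+-comm c b) ⟩
  a + (b + c) ≡⟨ +-assoc a b c ⟨
  a + b + c   ≡⟨ cong₂ _+_ ab≡xy c≡z ⟩
  x + y + z   ≡⟨ +-assoc x y z ⟩
  x + (y + z) ≡⟨ cong (x +_) (+-comm y z) ⟩
  x + (z + y) ≡⟨ +-assoc x z y ⟨
  x + z + y   ∎
  where open ≡-Reasoning

mutual
  fromX-size : ∀ x → size (fromX x) ≡ xsize x
  fromX-size xnil         = refl
  fromX-size (xzero x y)  = cong suc (cong₂ _+_ (fromX-size x) (fromY-size y))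
  fromX-size (xlevel x y) = cong suc (unspine-size x y)

  fromY-size : ∀ y → size (fromY y) ≡ ysize y
  fromY-size ynil         = refl
  fromY-size (ylevel x y) = cong suc (unspine-size x y)

  unspine-size : ∀ x y → size (proj₁ (unspine x y)) + size (proj₂ (unspine x y)) ≡ xsize x + ysize y
  unspine-size (xlevel x y') y =
    cong suc (interchange (size (proj₁ u)) (size (proj₂ u)) (xsize x) (ysize y)
                          (unspine-size x y) (fromY-size y'))
    where u = unspine x y
  unspine-size xnil          y = trans (+-identityʳ (size (fromY y))) (fromY-size y)
  unspine-size (xzero p q)   y =
    trans (+-comm (size (fromY y)) _) (cong₂ _+_ (fromX-size (xzero p q)) (fromY-size y))

mutual
  fromX-blacks : ∀ x → blackCount (fromX x) ≡ xasc true x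
  fromX-blacks xnil         = refl
  fromX-blacks (xzero x y)  = cong₂ _+_ (fromX-blacks x) (fromY-blacks y)
  fromX-blacks (xlevel x y) = cong suc (unspine-blacks x y)

  fromY-blacks : ∀ y → blackCount (fromY y) ≡ yasc y
  fromY-blacks ynil         = refl
  fromY-blacks (ylevel x y) = cong suc (unspine-blacks x y)

  unspine-blacks : ∀ x y →
    blackCount (proj₁ (unspine x y)) + blackCount (proj₂ (unspine x y)) ≡ xasc false x + yasc y
  unspine-blacks (xlevel x y') y =
    interchange (blackCount (proj₁ u)) (blackCount (proj₂ u)) (xasc false x) (yasc y)
                (unspine-blacks x y) (fromY-blacks y')
    where u = unspine x y
  unspine-blacks xnil          y = trans (+-identityʳ (blackCount (fromY y))) (fromY-blacks y)
  unspine-blacks (xzero p q)   y =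
    trans (+-comm (blackCount (fromY y)) _) (cong₂ _+_ (fromX-blacks (xzero p q)) (fromY-blacks y))

toX-size : ∀ t → ValidColoring t → xsize (toX t) ≡ size t
toX-size t valid = begin
  xsize (toX t)         ≡⟨ fromX-size (toX t) ⟨
  size (fromX (toX t))  ≡⟨ cong size (fromX-toX t valid) ⟩
  size t                ∎
  where open ≡-Reasoning

toX-blacks : ∀ t → ValidColoring t → xasc true (toX t) ≡ blackCount t
toX-blacks t valid = begin
  xasc true (toX t)           ≡⟨ fromX-blacks (toX t) ⟨
  blackCount (fromX (toX t))  ≡⟨ cong blackCount (fromX-toX t valid) ⟩
  blackCount t                ∎
  where open ≡-Reasoning

-- (2) Admissible lists and 021-avoiding inversion sequences

-- `Admissible j lo l`: the entries of l, placed at positions j, j+1, …, are each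
-- 0 or a value v with lo ≤ v ≤ (its position); a positive entry becomes the new
-- lower bound, so the positive entries weakly increase.
Admissible : ℕ → ℕ → List ℕ → Set
Admissible j lo []       = ⊤
Admissible j lo (v ∷ vs) =
  (v ≡ 0 × Admissible (suc j) lo vs) ⊎ ((lo ≤ v × v ≤ j × 0 < v) × Admissible (suc j) v vs)

admissible-weaken : ∀ {j lo lo'} l → lo' ≤ lo → Admissible j lo l → Admissible j lo' l
admissible-weaken []      _      _                         = tt
admissible-weaken (v ∷ l) lo'≤lo (inj₁ (v≡0 , adm)) =
  inj₁ (v≡0 , admissible-weaken l lo'≤lo adm)
admissible-weaken (v ∷ l) lo'≤lo (inj₂ ((lo≤v , b) , adm)) =
  inj₂ ((≤-trans lo'≤lo lo≤v , b) , adm)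

-- Admissibility is decidable, so it can be recomputed from irrelevant evidence.
admissible? : ∀ j lo l → Dec (Admissible j lo l)
admissible? j lo []       = yes tt
admissible? j lo (v ∷ vs) =
  ((v ≟ 0) ×-dec admissible? (suc j) lo vs) ⊎-dec
  (((lo ≤? v) ×-dec (v ≤? j) ×-dec (0 <? v)) ×-dec admissible? (suc j) v vs)

record Shape {n : ℕ} (j lo : ℕ) (e : Vec ℕ n) : Set where
  field
    bounded    : ∀ i → lookup e i ≤ j + toℕ i
    floored    : ∀ i → 0 < lookup e i → lo ≤ lookup e i
    increasing : ∀ i k → i <ᶠ k → 0 < lookup e i → 0 < lookup e k → lookup e i ≤ lookup e k
open Shape

cons-shape : ∀ {n j lo lo' v} {e : Vec ℕ n} → lo ≤ lo' → v ≤ j → (0 < v → lo' ≡ v) →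
  Shape (suc j) lo' e → Shape j lo (v ∷ᵛ e)
cons-shape {j = j} {lo} {lo'} {v} {e} lo≤lo' v≤j v≡lo' S = record
  { bounded = bnd ; floored = flr ; increasing = inc }
  where
    bnd : ∀ i → lookup (v ∷ᵛ e) i ≤ j + toℕ i
    bnd fzero    = subst (v ≤_) (sym (+-identityʳ j)) v≤j
    bnd (fsuc i) = subst (lookup e i ≤_) (sym (+-suc j (toℕ i))) (bounded S i)
    flr : ∀ i → 0 < lookup (v ∷ᵛ e) i → lo ≤ lookup (v ∷ᵛ e) i
    flr fzero    0<v = subst (lo ≤_) (v≡lo' 0<v) lo≤lo'
    flr (fsuc i) pos = ≤-trans lo≤lo' (floored S i pos)
    inc : ∀ i k → i <ᶠ k → 0 < lookup (v ∷ᵛ e) i → 0 < lookup (v ∷ᵛ e) k →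
          lookup (v ∷ᵛ e) i ≤ lookup (v ∷ᵛ e) k
    inc fzero    (fsuc k) _   0<v pos = subst (_≤ lookup e k) (v≡lo' 0<v) (floored S k pos)
    inc (fsuc i) (fsuc k) i<k         = increasing S i k (s≤s⁻¹ i<k)

tail-shape : ∀ {n j lo lo' v} {e : Vec ℕ n} → (∀ i → 0 < lookup e i → lo' ≤ lookup e i) →
  Shape j lo (v ∷ᵛ e) → Shape (suc j) lo' e
tail-shape {j = j} {e = e} flr S = record
  { bounded    = λ i → subst (lookup e i ≤_) (+-suc j (toℕ i)) (bounded S (fsuc i))
  ; floored    = flr
  ; increasing = λ i k i<k → increasing S (fsuc i) (fsuc k) (s≤s i<k)
  }

admissible⇒shape : ∀ {n} j lo (e : Vec ℕ n) → Admissible j lo (toList e) → Shape j lo e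
admissible⇒shape j lo []ᵛ _ = record { bounded = λ () ; floored = λ () ; increasing = λ () }
admissible⇒shape j lo (v ∷ᵛ e) (inj₁ (refl , adm)) =
  cons-shape ≤-refl z≤n (λ ()) (admissible⇒shape (suc j) lo e adm)
admissible⇒shape j lo (v ∷ᵛ e) (inj₂ ((lo≤v , v≤j , _) , adm)) =
  cons-shape lo≤v v≤j (λ _ → refl) (admissible⇒shape (suc j) v e adm)

shape⇒admissible : ∀ {n} j lo (e : Vec ℕ n) → Shape j lo e → Admissible j lo (toList e)
shape⇒admissible j lo []ᵛ                _ = tt
shape⇒admissible j lo (zero ∷ᵛ e)        S =
  inj₁ (refl , shape⇒admissible (suc j) lo e (tail-shape (λ i → floored S (fsuc i)) S))
shape⇒admissible j lo (v@(suc _) ∷ᵛ e) S =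
  inj₂ ((floored S fzero (s≤s z≤n) , subst (v ≤_) (+-identityʳ j) (bounded S fzero) , s≤s z≤n) ,
        shape⇒admissible (suc j) v e
          (tail-shape (λ i → increasing S fzero (fsuc i) (s≤s z≤n) (s≤s z≤n)) S))

-- A pattern 021 consists of two positive entries in decreasing order.
increasing⇒avoids021 : ∀ {n} (e : Vec ℕ n) →
  (∀ i k → i <ᶠ k → 0 < lookup e i → 0 < lookup e k → lookup e i ≤ lookup e k) → Avoids021 e
increasing⇒avoids021 e inc i j k _ j<k (eᵢ<eₖ , eₖ<eⱼ) =
  <⇒≱ eₖ<eⱼ (inc j k j<k (≤-trans (s≤s z≤n) eₖ<eⱼ) (≤-trans (s≤s z≤n) eᵢ<eₖ))

-- Conversely, two positive entries in decreasing order form a 021 together with e₁ = 0.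
avoids021⇒increasing : ∀ {n} (e : Vec ℕ n) → IsInversionSeq e → Avoids021 e →
  ∀ i k → i <ᶠ k → 0 < lookup e i → 0 < lookup e k → lookup e i ≤ lookup e k
avoids021⇒increasing e inv av fzero    k _   0<e₀ _ = ⊥-elim (<⇒≱ 0<e₀ (s≤s⁻¹ (inv fzero)))
avoids021⇒increasing e inv av (fsuc i) k i<k _ 0<eₖ with lookup e (fsuc i) ≤? lookup e k
... | yes eᵢ≤eₖ = eᵢ≤eₖ
... | no  eᵢ≰eₖ = ⊥-elim (av fzero (fsuc i) k (s≤s z≤n) i<k
                    (subst (_< lookup e k) (sym (n<1⇒n≡0 (inv fzero))) 0<eₖ , ≰⇒> eᵢ≰eₖ))

admissible⇒inversion021 : ∀ {n} (e : Vec ℕ n) → Admissible 0 1 (toList e) →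
  IsInversionSeq e × Avoids021 e
admissible⇒inversion021 e adm =
  (λ i → s≤s (bounded S i)) , increasing⇒avoids021 e (increasing S)
  where S = admissible⇒shape 0 1 e adm

inversion021⇒admissible : ∀ {n} (e : Vec ℕ n) → IsInversionSeq e → Avoids021 e →
  Admissible 0 1 (toList e)
inversion021⇒admissible e inv av = shape⇒admissible 0 1 e record
  { bounded    = λ i → s≤s⁻¹ (inv i)
  ; floored    = λ _ pos → pos
  ; increasing = avoids021⇒increasing e inv av
  }

-- (3) Encoding codes as sequences

-- `encX m x` writes the X-code x at level m.  In a node, the Y-part is written at
-- level m + |x| + 1, one above every value the X-part can use.
mutual
  encX : ℕ → XCode → List ℕ
  encX m xnil         = []
  encX m (xzero x y)  = 0 ∷ encPair m x y
  encX m (xlevel x y) = m ∷ encPair m x y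

  encY : ℕ → YCode → List ℕ
  encY m ynil         = []
  encY m (ylevel x y) = m ∷ encPair m x y

  encPair : ℕ → XCode → YCode → List ℕ
  encPair m x y = encX m x ++ encY (suc (m + xsize x)) y

mutual
  encX-length : ∀ m x → length (encX m x) ≡ xsize x
  encX-length m xnil         = refl
  encX-length m (xzero x y)  = cong suc (encPair-length m x y)
  encX-length m (xlevel x y) = cong suc (encPair-length m x y)

  encY-length : ∀ m y → length (encY m y) ≡ ysize y
  encY-length m ynil         = refl
  encY-length m (ylevel x y) = cong suc (encPair-length m x y)

  encPair-length : ∀ m x y → length (encPair m x y) ≡ xsize x + ysize y
  encPair-length m x y =
    trans (length-++ (encX m x)) (cong₂ _+_ (encX-length m x) (encY-length _ y))

node-offset : ∀ j a b → j + suc (a + b) ≡ suc j + a + b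
node-offset j a b = trans (+-suc j (a + b)) (cong suc (sym (+-assoc j a b)))

mutual
  encX-admissible : ∀ m x {j lo r} → 1 ≤ m → m ≤ j → lo ≤ m →
    Admissible (j + xsize x) (m + xsize x) r → Admissible j lo (encX m x ++ r)
  encX-admissible m xnil {j} {r = r} _ _ lo≤m adm =
    admissible-weaken r lo≤m (subst₂ (λ p q → Admissible p q r) (+-identityʳ j) (+-identityʳ m) adm)
  encX-admissible m (xzero x y) 1≤m m≤j lo≤m adm =
    inj₁ (refl , encPair-admissible m x y 1≤m m≤j lo≤m adm)
  encX-admissible m (xlevel x y) 1≤m m≤j lo≤m adm =
    inj₂ ((lo≤m , m≤j , 1≤m) , encPair-admissible m x y 1≤m m≤j ≤-refl adm)

  encY-admissible : ∀ m y {j lo r} → 1 ≤ m → m ≤ j → lo ≤ m →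
    Admissible (j + ysize y) (m + ysize y) r → Admissible j lo (encY m y ++ r)
  encY-admissible m ynil {j} {r = r} _ _ lo≤m adm =
    admissible-weaken r lo≤m (subst₂ (λ p q → Admissible p q r) (+-identityʳ j) (+-identityʳ m) adm)
  encY-admissible m (ylevel x y) 1≤m m≤j lo≤m adm =
    inj₂ ((lo≤m , m≤j , 1≤m) , encPair-admissible m x y 1≤m m≤j ≤-refl adm)

  encPair-admissible : ∀ m x y {j lo r} → 1 ≤ m → m ≤ j → lo ≤ m →
    Admissible (j + nodeSize x y) (m + nodeSize x y) r → Admissible (suc j) lo (encPair m x y ++ r)
  encPair-admissible m x y {j} {lo} {r} 1≤m m≤j lo≤m adm =
    subst (Admissible (suc j) lo) (sym (++-assoc (encX m x) (encY m' y) r))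
      (encX-admissible m x 1≤m (m≤n⇒m≤1+n m≤j) lo≤m
        (admissible-weaken (encY m' y ++ r) (n≤1+n _)
          (encY-admissible m' y (s≤s z≤n) (s≤s (+-monoˡ-≤ (xsize x) m≤j)) ≤-refl
            (subst₂ (λ p q → Admissible p q r) (node-offset j _ _) (node-offset m _ _) adm))))
    where m' = suc (m + xsize x)

-- `StartsAbove b l`: l is empty or begins with an entry above b; this marks the
-- place where the encoding of a code at level m ends (b = m + size).
StartsAbove : ℕ → List ℕ → Set
StartsAbove b []      = ⊤
StartsAbove b (v ∷ _) = b < v

startsAbove-lower : ∀ {b c} r → b ≤ c → StartsAbove c r → StartsAbove b r
startsAbove-lower []      _   _   = tt
startsAbove-lower (v ∷ _) b≤c c<v = ≤-<-trans b≤c c<v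

startsAbove-head : ∀ {b v r t} → r ≡ v ∷ t → StartsAbove b r → b < v
startsAbove-head refl b<v = b<v

encY-startsAbove : ∀ m x y r → StartsAbove (m + nodeSize x y) r →
  StartsAbove (m + xsize x) (encY (suc (m + xsize x)) y ++ r)
encY-startsAbove m x (ylevel _ _) r _  = n<1+n (m + xsize x)
encY-startsAbove m x ynil         r st =
  startsAbove-lower r (+-monoʳ-≤ m (m≤n⇒m≤1+n (m≤m+n (xsize x) 0))) st

record Parse {C : Set} (enc : C → List ℕ) (size : C → ℕ) (m j : ℕ) (l : List ℕ) : Set where
  constructor parsed
  field
    code           : C
    rest           : List ℕ
    splits         : l ≡ enc code ++ rest
    stops          : StartsAbove (m + size code) rest
    floor          : ℕ
    restAdmissible : Admissible (j + size code) floor rest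

-- Parses at level m from position j; for the body of a node, j is the position
-- of the node's head entry, so that the body starts at suc j.
ParseX : ℕ → ℕ → List ℕ → Set
ParseX m = Parse (encX m) xsize m

ParseY : ℕ → ℕ → List ℕ → Set
ParseY m = Parse (encY m) ysize m

ParsePair : ℕ → ℕ → List ℕ → Set
ParsePair m = Parse (uncurry (encPair m)) (uncurry nodeSize) m

emptyParse : ∀ {C enc size m j lo l} (c : C) → enc c ≡ [] → size c ≡ 0 →
  StartsAbove m l → Admissible j lo l → Parse {C} enc size m j l
emptyParse {m = m} {j} {lo} {l} c enc≡[] size≡0 st adm =
  parsed c l (cong (_++ l) (sym enc≡[]))
    (subst (λ b → StartsAbove b l) (sym (trans (cong (m +_) size≡0) (+-identityʳ m))) st)
    lo (subst (λ p → Admissible p lo l) (sym (trans (cong (j +_) size≡0) (+-identityʳ j))) adm)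

xzeroParse : ∀ {m j l} → ParsePair m j l → ParseX m j (0 ∷ l)
xzeroParse (parsed (x , y) r l≡ st lo adm) = parsed (xzero x y) r (cong (0 ∷_) l≡) st lo adm

xlevelParse : ∀ {m j l} → ParsePair m j l → ParseX m j (m ∷ l)
xlevelParse {m} (parsed (x , y) r l≡ st lo adm) = parsed (xlevel x y) r (cong (m ∷_) l≡) st lo adm

ylevelParse : ∀ {m j l} → ParsePair m j l → ParseY m j (m ∷ l)
ylevelParse {m} (parsed (x , y) r l≡ st lo adm) = parsed (ylevel x y) r (cong (m ∷_) l≡) st lo adm

suffix-length : ∀ {l : List ℕ} a r → l ≡ a ++ r → length r ≤ length l
suffix-length a r refl = length-++-≤ʳ r {a}

-- Greedy parsing of admissible lists (by recursion on a bound on the length):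
-- at level m, an entry 0 or m opens an X-node and an entry m opens a Y-node;
-- any other entry ends the code.
mutual
  parseX : ∀ fuel m j lo l → length l ≤ fuel → m ≤ lo → Admissible j lo l → ParseX m j l
  parseX _       m j lo []      _         _    _   = emptyParse {lo = lo} xnil refl refl tt tt
  parseX zero    m j lo (v ∷ l) ()        _    _
  parseX (suc f) m j lo (.0 ∷ l) (s≤s len) m≤lo (inj₁ (refl , adm)) =
    xzeroParse (parsePair f m j lo l len m≤lo adm)
  parseX (suc f) m j lo (v ∷ l) (s≤s len) m≤lo (inj₂ (bounds@(lo≤v , _) , adm)) with m ≟ v
  ... | yes refl = xlevelParse (parsePair f m j m l len ≤-refl adm)
  ... | no m≢v   = emptyParse xnil refl refl (≤∧≢⇒< (≤-trans m≤lo lo≤v) m≢v) (inj₂ (bounds , adm))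

  parseY : ∀ fuel b j lo l → length l ≤ fuel → StartsAbove b l → Admissible j lo l →
    ParseY (suc b) j l
  parseY _       b j lo []       _         _   _  = emptyParse {lo = lo} ynil refl refl tt tt
  parseY zero    b j lo (v ∷ l)  ()        _   _
  parseY (suc f) b j lo (.0 ∷ l) (s≤s len) ()  (inj₁ (refl , _))
  parseY (suc f) b j lo (v ∷ l)  (s≤s len) b<v (inj₂ (bounds , adm)) with suc b ≟ v
  ... | yes refl = ylevelParse (parsePair f (suc b) j (suc b) l len ≤-refl adm)
  ... | no sb≢v  = emptyParse ynil refl refl (≤∧≢⇒< b<v sb≢v) (inj₂ (bounds , adm))

  parsePair : ∀ fuel m j lo l → length l ≤ fuel → m ≤ lo → Admissible (suc j) lo l →
    ParsePair m j l
  parsePair f m j lo l len m≤lo adm with parseX f m (suc j) lo l len m≤lo adm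
  ... | parsed x r₁ l≡ st₁ lo₁ adm₁
    with parseY f (m + xsize x) (suc j + xsize x) lo₁ r₁
                (≤-trans (suffix-length (encX m x) r₁ l≡) len) st₁ adm₁
  ...   | parsed y r₂ r₁≡ st₂ lo₂ adm₂ =
    parsed (x , y) r₂ (trans l≡ (trans (cong (encX m x ++_) r₁≡) (sym (++-assoc (encX m x) _ r₂))))
      (subst (λ b → StartsAbove b r₂) (sym (node-offset m (xsize x) (ysize y))) st₂)
      lo₂ (subst (λ p → Admissible p lo₂ r₂) (sym (node-offset j (xsize x) (ysize y))) adm₂)

-- Unique decoding: a code is determined by its encoding, provided what follows
-- starts above its range.  Heads 0 and m ≥ 1 tell Z from P, and the end marker
-- tells an empty code from a node.
mutual
  encX-unique : ∀ m x x' r r' → 1 ≤ m → encX m x ++ r ≡ encX m x' ++ r' →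
    StartsAbove (m + xsize x) r → StartsAbove (m + xsize x') r' → x ≡ x' × r ≡ r'
  encX-unique m xnil         xnil          r r' _ e _  _  = refl , e
  encX-unique m xnil         (xzero _ _)   r r' _ e st _  with () ← startsAbove-head e st
  encX-unique m xnil         (xlevel _ _)  r r' _ e st _  = ⊥-elim (m+n≮m m 0 (startsAbove-head e st))
  encX-unique m (xzero _ _)  xnil          r r' _ e _ st' with () ← startsAbove-head (sym e) st'
  encX-unique m (xlevel _ _) xnil          r r' _ e _ st' =
    ⊥-elim (m+n≮m m 0 (startsAbove-head (sym e) st'))
  encX-unique m (xzero _ _)  (xlevel _ _)  r r' 1≤m e _ _
    with () ← subst (1 ≤_) (sym (∷-injectiveˡ e)) 1≤m
  encX-unique m (xlevel _ _) (xzero _ _)   r r' 1≤m e _ _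
    with () ← subst (1 ≤_) (∷-injectiveˡ e) 1≤m
  encX-unique m (xzero x y)  (xzero x' y') r r' 1≤m e st st'
    with encPair-unique m x y x' y' r r' 1≤m (∷-injectiveʳ e) st st'
  ... | refl , refl , refl = refl , refl
  encX-unique m (xlevel x y) (xlevel x' y') r r' 1≤m e st st'
    with encPair-unique m x y x' y' r r' 1≤m (∷-injectiveʳ e) st st'
  ... | refl , refl , refl = refl , refl

  encY-unique : ∀ m y y' r r' → 1 ≤ m → encY m y ++ r ≡ encY m y' ++ r' →
    StartsAbove (m + ysize y) r → StartsAbove (m + ysize y') r' → y ≡ y' × r ≡ r'
  encY-unique m ynil         ynil          r r' _ e _  _  = refl , e
  encY-unique m ynil         (ylevel _ _)  r r' _ e st _  = ⊥-elim (m+n≮m m 0 (startsAbove-head e st))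
  encY-unique m (ylevel _ _) ynil          r r' _ e _ st' =
    ⊥-elim (m+n≮m m 0 (startsAbove-head (sym e) st'))
  encY-unique m (ylevel x y) (ylevel x' y') r r' 1≤m e st st'
    with encPair-unique m x y x' y' r r' 1≤m (∷-injectiveʳ e) st st'
  ... | refl , refl , refl = refl , refl

  encPair-unique : ∀ m x y x' y' r r' → 1 ≤ m → encPair m x y ++ r ≡ encPair m x' y' ++ r' →
    StartsAbove (m + nodeSize x y) r → StartsAbove (m + nodeSize x' y') r' →
    x ≡ x' × y ≡ y' × r ≡ r'
  encPair-unique m x y x' y' r r' 1≤m e st st'
    with encX-unique m x x' (encY _ y ++ r) (encY _ y' ++ r') 1≤m
           (trans (sym (++-assoc (encX m x) _ r)) (trans e (++-assoc (encX m x') _ r')))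
           (encY-startsAbove m x y r st) (encY-startsAbove m x' y' r' st')
  ... | refl , e'
    with encY-unique (suc (m + xsize x)) y y' r r' (s≤s z≤n) e'
           (subst (λ b → StartsAbove b r) (node-offset m (xsize x) (ysize y)) st)
           (subst (λ b → StartsAbove b r') (node-offset m (xsize x) (ysize y')) st')
  ... | refl , refl = refl , refl , refl

ascentsAfter : ℕ → List ℕ → ℕ
ascentsAfter p l = ascentsL (p ∷ l)

final : ℕ → List ℕ → ℕ
final p []      = p
final p (v ∷ l) = final v l

ascentsAfter-++ : ∀ p a b → ascentsAfter p (a ++ b) ≡ ascentsAfter p a + ascentsAfter (final p a) b
ascentsAfter-++ p []      b = refl
ascentsAfter-++ p (v ∷ a) b =
  trans (cong (bit (does (p <? v)) +_) (ascentsAfter-++ v a b))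
        (sym (+-assoc (bit (does (p <? v))) (ascentsAfter v a) _))

final-++ : ∀ p a b → final p (a ++ b) ≡ final (final p a) b
final-++ p []      b = refl
final-++ p (v ∷ a) b = final-++ v a b

mutual
  encX-final : ∀ p m x → p ≤ m → final p (encX m x) ≤ m + xsize x
  encX-final p m xnil         p≤m = ≤-trans p≤m (m≤m+n m 0)
  encX-final p m (xzero x y)  _   = encPair-final 0 m x y z≤n
  encX-final p m (xlevel x y) _   = encPair-final m m x y ≤-refl

  encY-final : ∀ p m y → p ≤ m → final p (encY m y) ≤ m + ysize y
  encY-final p m ynil         p≤m = ≤-trans p≤m (m≤m+n m 0)
  encY-final p m (ylevel x y) _   = encPair-final m m x y ≤-refl

  encPair-final : ∀ v m x y → v ≤ m → final v (encPair m x y) ≤ m + nodeSize x y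
  encPair-final v m x y v≤m = begin
    final v (encPair m x y)                 ≡⟨ final-++ v (encX m x) _ ⟩
    final (final v (encX m x)) (encY m' y)  ≤⟨ encY-final _ m' y (m≤n⇒m≤1+n (encX-final v m x v≤m)) ⟩
    m' + ysize y                            ≡⟨ node-offset m (xsize x) (ysize y) ⟨
    m + nodeSize x y                        ∎
    where open ≤-Reasoning
          m' = suc (m + xsize x)

-- The two predecessors a node body can have: 0 (below the level) or the level itself.
below-level : ∀ {m} → 1 ≤ m → does (0 <? m) ≡ true
below-level {m} 1≤m = dec-true (0 <? m) 1≤m

at-level : ∀ m → does (m <? m) ≡ false
at-level m = dec-false (m <? m) (n≮n m)

mutual
  encX-ascents : ∀ p m x → 1 ≤ m → p ≤ m → ascentsAfter p (encX m x) ≡ xasc (does (p <? m)) x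
  encX-ascents p m xnil         _   _ = refl
  encX-ascents p m (xzero x y)  1≤m _ =
    trans (encPair-ascents 0 m x y 1≤m z≤n) (cong (λ b → xasc b x + yasc y) (below-level 1≤m))
  encX-ascents p m (xlevel x y) 1≤m _ =
    cong (bit (does (p <? m)) +_)
      (trans (encPair-ascents m m x y 1≤m ≤-refl) (cong (λ b → xasc b x + yasc y) (at-level m)))

  encY-ascents : ∀ p m y → p < m → ascentsAfter p (encY m y) ≡ yasc y
  encY-ascents p m ynil         _   = refl
  encY-ascents p m (ylevel x y) p<m =
    cong₂ _+_ (cong bit (dec-true (p <? m) p<m))
      (trans (encPair-ascents m m x y (≤-trans (s≤s z≤n) p<m) ≤-refl)
             (cong (λ b → xasc b x + yasc y) (at-level m)))

  encPair-ascents : ∀ v m x y → 1 ≤ m → v ≤ m →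
    ascentsAfter v (encPair m x y) ≡ xasc (does (v <? m)) x + yasc y
  encPair-ascents v m x y 1≤m v≤m =
    trans (ascentsAfter-++ v (encX m x) _)
      (cong₂ _+_ (encX-ascents v m x 1≤m v≤m)
                 (encY-ascents _ (suc (m + xsize x)) y (s≤s (encX-final v m x v≤m))))

-- (4) The bijections

Sub-≡ : ∀ {A : Set} {P : A → Set} {a b : Sub P} → Sub.val a ≡ Sub.val b → a ≡ b
Sub-≡ {a = ⟨ _ , _ ⟩} {⟨ _ , _ ⟩} refl = refl

-- Validity of a colouring is decidable, so it can be recomputed from the
-- irrelevant proof stored with a tree.
_≟ᶜ_ : (c d : Color) → Dec (c ≡ d)
black ≟ᶜ black = yes refl
black ≟ᶜ white = no (λ ())
white ≟ᶜ black = no (λ ())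
white ≟ᶜ white = yes refl

valid? : ∀ t → Dec (ValidColoring t)
valid? leaf         = yes tt
valid? (node c l r) = valid? l ×-dec valid? r ×-dec differs? r
  where
    differs? : ∀ t → Dec (DiffersFromRoot c t)
    differs? leaf           = yes tt
    differs? (node c' _ _) = ¬? (c ≟ᶜ c')

Codes : ℕ → ℕ → Set
Codes n k = Sub (λ s → xsize s ≡ n × xasc true s ≡ k)

trees↔codes : ∀ n k → TreesWithBlacks n k ↔ Codes n k
trees↔codes n k = mk↔ₛ′ to from to∘from from∘to
  where
    to : TreesWithBlacks n k → Codes n k
    to ⟨ t , p ⟩ = ⟨ toX t , ( trans (toX-size t (proj₁ (proj₂ p))) (proj₁ p)
                             , trans (toX-blacks t (proj₁ (proj₂ p))) (proj₂ (proj₂ p))) ⟩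
    from : Codes n k → TreesWithBlacks n k
    from ⟨ s , q ⟩ =
      ⟨ fromX s , (trans (fromX-size s) (proj₁ q) , fromX-valid s , trans (fromX-blacks s) (proj₂ q)) ⟩
    to∘from : ∀ c → to (from c) ≡ c
    to∘from ⟨ s , _ ⟩ = Sub-≡ (toX-fromX s)
    from∘to : ∀ t → from (to t) ≡ t
    from∘to ⟨ t , p ⟩ = Sub-≡ (fromX-toX t (recompute (valid? t) (proj₁ (proj₂ p))))

-- A list as a vector of prescribed length (used only on lists of that length).
listToVec : (n : ℕ) → List ℕ → Vec ℕ n
listToVec zero    _       = []ᵛ
listToVec (suc n) []      = 0 ∷ᵛ listToVec n []
listToVec (suc n) (v ∷ l) = v ∷ᵛ listToVec n l

toList-listToVec : ∀ n l → length l ≡ n → toList (listToVec n l) ≡ l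
toList-listToVec zero    []      _    = refl
toList-listToVec (suc n) (v ∷ l) len = cong (v ∷_) (toList-listToVec n l (suc-injective len))

listToVec-toList : ∀ {n} (xs : Vec ℕ n) → listToVec n (toList xs) ≡ xs
listToVec-toList []ᵛ       = refl
listToVec-toList (x ∷ᵛ xs) = cong (x ∷ᵛ_) (listToVec-toList xs)

codeSeq : ∀ n → XCode → Vec ℕ (suc n)
codeSeq n s = 0 ∷ᵛ listToVec n (encX 1 s)

toList-codeSeq : ∀ n s → xsize s ≡ n → toList (codeSeq n s) ≡ 0 ∷ encX 1 s
toList-codeSeq n s size≡n =
  cong (0 ∷_) (toList-listToVec n (encX 1 s) (trans (encX-length 1 s) size≡n))

code-admissible : ∀ s → Admissible 0 1 (0 ∷ encX 1 s)
code-admissible s = inj₁ (refl , subst (Admissible 1 1) (++-identityʳ (encX 1 s))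
                                  (encX-admissible 1 s (s≤s z≤n) (s≤s z≤n) (s≤s z≤n) tt))

code-ascents : ∀ s → ascentsL (0 ∷ encX 1 s) ≡ xasc true s
code-ascents s = encX-ascents 0 1 s (s≤s z≤n) z≤n

codeSeq-props : ∀ n k s → xsize s ≡ n × xasc true s ≡ k →
  IsInversionSeq (codeSeq n s) × Avoids021 (codeSeq n s) × ascents (codeSeq n s) ≡ k
codeSeq-props n k s (size≡n , asc≡k) =
  map₂ (_, trans (cong ascentsL seq≡) (trans (code-ascents s) asc≡k))
       (admissible⇒inversion021 (codeSeq n s) (subst (Admissible 0 1) (sym seq≡) (code-admissible s)))
  where
    seq≡ : toList (codeSeq n s) ≡ 0 ∷ encX 1 s
    seq≡ = toList-codeSeq n s size≡n

encX-injective : ∀ m s s' → 1 ≤ m → encX m s ≡ encX m s' → s ≡ s'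
encX-injective m s s' 1≤m e =
  proj₁ (encX-unique m s s' [] [] 1≤m
           (trans (++-identityʳ _) (trans e (sym (++-identityʳ _)))) tt tt)

exhausted : ∀ {j lo} r → StartsAbove j r → Admissible j lo r → r ≡ []
exhausted []      _   _                           = refl
exhausted (v ∷ r) ()  (inj₁ (refl , _))
exhausted (v ∷ r) j<v (inj₂ ((_ , v≤j , _) , _)) = ⊥-elim (<⇒≱ j<v v≤j)

decode : ∀ l → Admissible 1 1 l → ∃ λ s → encX 1 s ≡ l
decode l adm with parseX (length l) 1 1 1 l ≤-refl ≤-refl adm
... | parsed s r l≡ st _ radm =
  s , sym (trans l≡ (trans (cong (encX 1 s ++_) (exhausted r st radm)) (++-identityʳ (encX 1 s))))

leading-zero : ∀ {lo v l} → Admissible 0 lo (v ∷ l) → v ≡ 0 × Admissible 1 lo l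
leading-zero (inj₁ v≡0,adm)               = v≡0,adm
leading-zero (inj₂ ((_ , v≤0 , 0<v) , _)) = ⊥-elim (<⇒≱ 0<v v≤0)

codeToSeq : ∀ n k → Codes n k → Inv021WithAscents (suc n) k
codeToSeq n k ⟨ s , q ⟩ = ⟨ codeSeq n s , codeSeq-props n k s q ⟩

codeToSeq-injective : ∀ n k {c c'} → codeToSeq n k c ≡ codeToSeq n k c' → c ≡ c'
codeToSeq-injective n k {⟨ s , q ⟩} {⟨ s' , q' ⟩} e =
  Sub-≡ (encX-injective 1 s s' (s≤s z≤n) (begin
    encX 1 s                          ≡⟨ toList-listToVec n _ (len s q) ⟨
    toList (listToVec n (encX 1 s))   ≡⟨ cong toList (proj₂ (∷-injective (cong Sub.val e))) ⟩
    toList (listToVec n (encX 1 s'))  ≡⟨ toList-listToVec n _ (len s' q') ⟩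
    encX 1 s'                         ∎))
  where
    open ≡-Reasoning
    len : ∀ s → .(xsize s ≡ n × xasc true s ≡ k) → length (encX 1 s) ≡ n
    len s q = trans (encX-length 1 s) (recompute (xsize s ≟ n) (proj₁ q))

preimage : ∀ n k x (xs : Vec ℕ n) → Admissible 0 1 (x ∷ toList xs) → .(ascents (x ∷ᵛ xs) ≡ k) →
  ∃ λ c → Sub.val (codeToSeq n k c) ≡ x ∷ᵛ xs
preimage n k x xs adm asc≡k with leading-zero adm
... | refl , adm₁ with decode (toList xs) adm₁
... | s , enc≡xs =
  ⟨ s , (size≡n , trans (sym (code-ascents s)) (trans (cong (λ l → ascentsL (0 ∷ l)) enc≡xs) asc≡k)) ⟩
  ,
  cong (0 ∷ᵛ_) (trans (cong (listToVec n) enc≡xs) (listToVec-toList xs))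
  where
    size≡n : xsize s ≡ n
    size≡n = trans (sym (encX-length 1 s)) (trans (cong length enc≡xs) (length-toList xs))

codeToSeq-surjective : ∀ n k y → ∃ λ c → ∀ {z} → z ≡ c → codeToSeq n k z ≡ y
codeToSeq-surjective n k ⟨ x ∷ᵛ xs , q ⟩
  with preimage n k x xs (recompute (admissible? 0 1 (x ∷ toList xs))
                           (inversion021⇒admissible (x ∷ᵛ xs) (proj₁ q) (proj₁ (proj₂ q))))
                         (proj₂ (proj₂ q))
... | c , val≡ = c , λ { refl → Sub-≡ val≡ }

codes⤖sequences : ∀ n k → Codes n k ⤖ Inv021WithAscents (suc n) k
codes⤖sequences n k = mk⤖ (codeToSeq-injective n k , codeToSeq-surjective n k)

theorem15 : (n k : ℕ) → 1 ≤ n → TreesWithBlacks (n ∸ 1) k ⤖ Inv021WithAscents n k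
theorem15 (suc n) k _ = codes⤖sequences n k ⤖-∘ ↔⇒⤖ (trees↔codes n k)
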